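{- Let $\mathbb F$ be a field, and let $\varphi$ be an $\mathbb F^\times$-gain function and $\psi$ an $\mathbb F^+$-gain function on $2C_3$, neither of which has a balanced 2-cycle. Then $A_F(2C_3,\varphi)$ and $A_L(2C_3,\psi)$ are not projectively equivalent.
   Context: $2C_3$ is a triangle with every edge doubled. Gain functions: $\varphi(e^{ -1})=\varphi(e)^{ -1}$ (multiplicative, $\mathbb F^\times$) or $\psi(e^{ -1})=-\psi(e)$ (additive, $\mathbb F^+$); a cycle is balanced if its gain (product, resp. sum, around it) is the identity. Frame matrix $A_F(G,\varphi)$: rows $V(G)$, link column $\hat{\mathrm{tail}(e)}-\varphi(e)\hat{\mathrm{head}(e)}$. Lift matrix $A_L(G,\psi)$: rows $V(G)\cup\{v_0\}$, link column $\hat{\mathrm{tail}(e)}-\hat{\mathrm{head}(e)}+\psi(e)\hat v_0$. Projectively equivalent: related by elementary row operations, nonzero column scalings, and deleting/adjoining zero rows. -}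

module Defs where

open import Level using (Level; _⊔_)
open import Algebra.Bundles using (CommutativeRing)
open import Data.Nat using (ℕ)
open import Data.Fin using (Fin; zero; suc; punchIn; _≟_)
open import Data.Bool using (Bool; true; false)
open import Data.Product using (Σ; ∃; _×_; _,_)
open import Relation.Nullary using (¬_; yes; no)
open import Relation.Binary.PropositionalEquality using (_≡_; _≢_)
open import Relation.Binary.Construct.Closure.ReflexiveTransitive using (Star)

record Field (c ℓ : Level) : Set (Level.suc (c ⊔ ℓ)) where
  field
    commRing : CommutativeRing c ℓ
  open CommutativeRing commRing public
  field
    1≉0      : ¬ (1# ≈ 0#)
    inverse  : ∀ x → ¬ (x ≈ 0#) → Σ Carrier (λ y → x * y ≈ 1#)

-- The graph 2C₃: vertices Fin 3, six edges.  Edges 0,1 join vertex 0 to 1;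
-- edges 2,3 join 1 to 2; edges 4,5 join 2 to 0.  Each edge carries a
-- reference orientation (tail → head).

Vertex : Set
Vertex = Fin 3

Edge : Set
Edge = Fin 6

tail : Edge → Vertex
tail zero = zero
tail (suc zero) = zero
tail (suc (suc zero)) = suc zero
tail (suc (suc (suc zero))) = suc zero
tail (suc (suc (suc (suc zero)))) = suc (suc zero)
tail (suc (suc (suc (suc (suc zero))))) = suc (suc zero)

head : Edge → Vertex
head zero = suc zero
head (suc zero) = suc zero
head (suc (suc zero)) = suc (suc zero)
head (suc (suc (suc zero))) = suc (suc zero)
head (suc (suc (suc (suc zero)))) = zero
head (suc (suc (suc (suc (suc zero))))) = zero

-- An oriented edge (dart): the edge together with a direction;
-- true = reference orientation e, false = reversed orientation e⁻¹.
Dart : Set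
Dart = Edge × Bool

Parallel : Edge → Edge → Set
Parallel e f = (e ≢ f) × (tail e ≡ tail f) × (head e ≡ head f)

module _ {c ℓ : Level} (F : Field c ℓ) where
  open Field F

  record MultGain : Set (c ⊔ ℓ) where
    field
      φ        : Dart → Carrier
      nonzero  : ∀ d → ¬ (φ d ≈ 0#)
      inv      : ∀ e → φ (e , false) * φ (e , true) ≈ 1#

  record AddGain : Set (c ⊔ ℓ) where
    field
      ψ        : Dart → Carrier
      inv      : ∀ e → ψ (e , false) ≈ - ψ (e , true)

  -- The 2-cycle through parallel edges e, f: traverse e from tail to head,
  -- then f backwards from head to tail.
  MultBalanced2Cycle : MultGain → Set ℓ
  MultBalanced2Cycle g =
    Σ Edge λ e → Σ Edge λ f → Parallel e f ×
      (MultGain.φ g (e , true) * MultGain.φ g (f , false) ≈ 1#)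

  AddBalanced2Cycle : AddGain → Set ℓ
  AddBalanced2Cycle g =
    Σ Edge λ e → Σ Edge λ f → Parallel e f ×
      (AddGain.ψ g (e , true) + AddGain.ψ g (f , false) ≈ 0#)

  Matrix : ℕ → ℕ → Set c
  Matrix m n = Fin m → Fin n → Carrier

  _≈ₘ_ : ∀ {m n} → Matrix m n → Matrix m n → Set ℓ
  A ≈ₘ B = ∀ i j → A i j ≈ B i j

  δ : ∀ {m} → Fin m → Fin m → Carrier
  δ i j with i ≟ j
  ... | yes _ = 1#
  ... | no  _ = 0#

  frameMatrix : MultGain → Matrix 3 6
  frameMatrix g v e = δ v (tail e) - MultGain.φ g (e , true) * δ v (head e)

  -- Lift matrix: rows v₀ (index zero) and V (index suc v),
  -- column e = tail(e)^ - head(e)^ + ψ(e) v₀^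
  liftMatrix : AddGain → Matrix 4 6
  liftMatrix g zero    e = AddGain.ψ g (e , true)
  liftMatrix g (suc v) e = δ v (tail e) - δ v (head e)

  swapIdx : ∀ {m} → Fin m → Fin m → Fin m → Fin m
  swapIdx i j r with r ≟ i | r ≟ j
  ... | yes _ | _     = j
  ... | no _  | yes _ = i
  ... | no _  | no _  = r

  SomeMatrix : ℕ → Set c
  SomeMatrix n = Σ ℕ λ m → Matrix m n

  DeleteZeroRow : ∀ {m n} → Matrix (ℕ.suc m) n → Matrix m n → Set ℓ
  DeleteZeroRow {m} {n} A B =
    Σ (Fin (ℕ.suc m)) λ k → (∀ j → A k j ≈ 0#) × (∀ i j → B i j ≈ A (punchIn k i) j)

  data Step {n : ℕ} : SomeMatrix n → SomeMatrix n → Set (c ⊔ ℓ) where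
    rowSwap  : ∀ {m} (A B : Matrix m n) (i j : Fin m) →
               (∀ r s → B r s ≈ A (swapIdx i j r) s) → Step (m , A) (m , B)
    rowScale : ∀ {m} (A B : Matrix m n) (i : Fin m) (a : Carrier) → ¬ (a ≈ 0#) →
               (∀ s → B i s ≈ a * A i s) →
               (∀ r → r ≢ i → ∀ s → B r s ≈ A r s) → Step (m , A) (m , B)
    rowAdd   : ∀ {m} (A B : Matrix m n) (i j : Fin m) (a : Carrier) → i ≢ j →
               (∀ s → B i s ≈ A i s + a * A j s) →
               (∀ r → r ≢ i → ∀ s → B r s ≈ A r s) → Step (m , A) (m , B)
    colScale : ∀ {m} (A B : Matrix m n) (a : Fin n → Carrier) → (∀ s → ¬ (a s ≈ 0#)) →
               (∀ r s → B r s ≈ A r s * a s) → Step (m , A) (m , B)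
    delZero  : ∀ {m} (A : Matrix (ℕ.suc m) n) (B : Matrix m n) →
               DeleteZeroRow A B → Step (ℕ.suc m , A) (m , B)
    addZero  : ∀ {m} (A : Matrix m n) (B : Matrix (ℕ.suc m) n) →
               DeleteZeroRow B A → Step (m , A) (ℕ.suc m , B)

  -- Projectively equivalent: related by a finite sequence of such steps
  -- (every step is invertible by a step, so this is an equivalence).
  ProjEquiv : ∀ {m m' n} → Matrix m n → Matrix m' n → Set (c ⊔ ℓ)
  ProjEquiv {m} {m'} A B = Star Step (m , A) (m' , B)

-- In the lift matrix the two columns of a parallel class differ only in the
-- row v₀, and since ψ(e) ≠ ψ(f) they span the unit vector of v₀: the column
-- spans of the three parallel classes share a nonzero vector.  In the frame
-- matrix the columns of the class leaving v lie in the coordinate plane of v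
-- and its successor, and the three coordinate planes meet only in 0.  Sharing
-- a nonzero vector survives projective equivalence; it is handled dually, by
-- linear functionals on rows supported on the classes, which row operations
-- and zero rows leave alone and column scalings merely rescale.
module Submission where

open import Defs
open import Level using (Level; _⊔_)
open import Data.Nat using (ℕ)
open import Data.Fin using (Fin; zero; suc; punchIn; punchOut; _≟_)
open import Data.Fin.Properties using (punchIn-punchOut)
open import Data.Product using (_×_; _,_; proj₁; proj₂; uncurry)
open import Data.Bool using (true)
open import Data.Empty using (⊥-elim)
open import Function.Base using (_∘_)
open import Function.Bundles using (_⇔_; mk⇔; Equivalence)
import Function.Properties.Equivalence as ⇔
open import Relation.Nullary using (¬_; Dec; yes; no)
open import Relation.Binary.PropositionalEquality as ≡ using (_≡_; _≢_)
open import Relation.Binary.Construct.Closure.ReflexiveTransitive using (Star; ε; _◅_)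
import Algebra.Properties.Ring as RingProperties
import Algebra.Properties.CommutativeSemigroup as CommutativeSemigroupProperties
import Relation.Binary.Reasoning.Setoid as SetoidReasoning

open Equivalence using (to; from)

module _ {m : ℕ} {c ℓ : Level} (F : Field c ℓ) where

  swapIdx-i : (i j : Fin m) → swapIdx F i j i ≡ j
  swapIdx-i i j with i ≟ i
  ... | yes _   = ≡.refl
  ... | no i≢i  = ⊥-elim (i≢i ≡.refl)

  swapIdx-j : (i j : Fin m) → swapIdx F i j j ≡ i
  swapIdx-j i j with j ≟ i | j ≟ j
  ... | yes j≡i | _       = j≡i
  ... | no _    | yes _   = ≡.refl
  ... | no _    | no j≢j  = ⊥-elim (j≢j ≡.refl)

  swapIdx-fixes : (i j r : Fin m) → r ≢ i → r ≢ j → swapIdx F i j r ≡ r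
  swapIdx-fixes i j r r≢i r≢j with r ≟ i | r ≟ j
  ... | yes r≡i | _       = ⊥-elim (r≢i r≡i)
  ... | no _    | yes r≡j = ⊥-elim (r≢j r≡j)
  ... | no _    | no _    = ≡.refl

  swapIdx-involutive : (i j r : Fin m) → swapIdx F i j (swapIdx F i j r) ≡ r
  swapIdx-involutive i j r = byCases (r ≟ i) (r ≟ j)
    where
    swap : Fin m → Fin m
    swap = swapIdx F i j
    Involutive : Fin m → Set
    Involutive x = swap (swap x) ≡ x
    byCases : Dec (r ≡ i) → Dec (r ≡ j) → Involutive r
    byCases (yes r≡i) _ =
      ≡.subst Involutive (≡.sym r≡i) (≡.trans (≡.cong swap (swapIdx-i i j)) (swapIdx-j i j))
    byCases (no _) (yes r≡j) =
      ≡.subst Involutive (≡.sym r≡j) (≡.trans (≡.cong swap (swapIdx-j i j)) (swapIdx-i i j))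
    byCases (no r≢i) (no r≢j) = ≡.trans (≡.cong swap fixed) fixed
      where fixed = swapIdx-fixes i j r r≢i r≢j

module RowSpace {c ℓ : Level} (F : Field c ℓ) where
  open Field F hiding (zero)
  open SetoidReasoning setoid

  open RingProperties ring using (x[y-z]≈xy-xz; -‿+-comm; x∙y⁻¹≈ε⇒x≈y; x≈y⇒x∙y⁻¹≈ε)
  open CommutativeSemigroupProperties +-commutativeSemigroup using (interchange)
  open CommutativeSemigroupProperties *-commutativeSemigroup using (x∙yz≈y∙xz; xy∙z≈y∙xz)

  x*y≈0∧x≉0⇒y≈0 : ∀ {x y} → x * y ≈ 0# → ¬ (x ≈ 0#) → y ≈ 0#
  x*y≈0∧x≉0⇒y≈0 {x} {y} xy≈0 x≉0 with inverse x x≉0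
  ... | x⁻¹ , xx⁻¹≈1 = begin
    y              ≈⟨ *-identityˡ y ⟨
    1# * y         ≈⟨ *-congʳ xx⁻¹≈1 ⟨
    x * x⁻¹ * y    ≈⟨ xy∙z≈y∙xz x x⁻¹ y ⟩
    x⁻¹ * (x * y)  ≈⟨ *-congˡ xy≈0 ⟩
    x⁻¹ * 0#       ≈⟨ zeroʳ x⁻¹ ⟩
    0#             ∎

  x+ay≈0∧y≈0⇒x≈0 : ∀ {x a y} → x + a * y ≈ 0# → y ≈ 0# → x ≈ 0#
  x+ay≈0∧y≈0⇒x≈0 {x} {a} {y} x+ay≈0 y≈0 = begin
    x           ≈⟨ +-identityʳ x ⟨
    x + 0#      ≈⟨ +-congˡ (trans (*-congˡ y≈0) (zeroʳ a)) ⟨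
    x + a * y   ≈⟨ x+ay≈0 ⟩
    0#          ∎

  [x+y]-[u+v]≈[x-u]+[y-v] : ∀ x y u v → (x + y) - (u + v) ≈ (x - u) + (y - v)
  [x+y]-[u+v]≈[x-u]+[y-v] x y u v = begin
    (x + y) + - (u + v)     ≈⟨ +-congˡ (-‿+-comm u v) ⟨
    (x + y) + (- u + - v)   ≈⟨ interchange x y (- u) (- v) ⟩
    (x - u) + (y - v)       ∎

  x-y≈0∧y≈0⇒x≈0 : ∀ {x y} → x - y ≈ 0# → y ≈ 0# → x ≈ 0#
  x-y≈0∧y≈0⇒x≈0 {x} {y} x-y≈0 y≈0 = trans (x∙y⁻¹≈ε⇒x≈y x y x-y≈0) y≈0

  Row : ℕ → Set c
  Row n = Fin n → Carrier

  _≈ᵣ_ : ∀ {n} → Row n → Row n → Set ℓ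
  x ≈ᵣ y = ∀ s → x s ≈ y s

  record LinearFunctional (n : ℕ) : Set (c ⊔ ℓ) where
    field
      apply       : Row n → Carrier
      apply-cong  : ∀ {x y} → x ≈ᵣ y → apply x ≈ apply y
      additive    : ∀ x y → apply (λ s → x s + y s) ≈ apply x + apply y
      homogeneous : ∀ k x → apply (λ s → k * x s) ≈ k * apply x

    apply-zero : ∀ {x} → x ≈ᵣ (λ _ → 0#) → apply x ≈ 0#
    apply-zero {x} x≈0 = begin
      apply x                 ≈⟨ apply-cong (λ s → trans (x≈0 s) (sym (zeroˡ (x s)))) ⟩
      apply (λ s → 0# * x s)  ≈⟨ homogeneous 0# x ⟩
      0# * apply x            ≈⟨ zeroˡ (apply x) ⟩
      0#                      ∎

    apply-scaled : ∀ {x y} k → x ≈ᵣ (λ s → k * y s) → apply x ≈ k * apply y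
    apply-scaled {y = y} k x≈ky = trans (apply-cong x≈ky) (homogeneous k y)

    apply-+* : ∀ {x y z} k → x ≈ᵣ (λ s → y s + k * z s) → apply x ≈ apply y + k * apply z
    apply-+* {x} {y} {z} k x≈y+kz = begin
      apply x                          ≈⟨ apply-cong x≈y+kz ⟩
      apply (λ s → y s + k * z s)      ≈⟨ additive y (λ s → k * z s) ⟩
      apply y + apply (λ s → k * z s)  ≈⟨ +-congˡ (homogeneous k z) ⟩
      apply y + k * apply z            ∎

  open LinearFunctional public

  _⊖_ : ∀ {n} → LinearFunctional n → LinearFunctional n → LinearFunctional n
  f ⊖ g = record
    { apply       = λ x → apply f x - apply g x
    ; apply-cong  = λ x≈y → +-cong (apply-cong f x≈y) (-‿cong (apply-cong g x≈y))
    ; additive    = λ x y → trans (+-cong (additive f x y) (-‿cong (additive g x y)))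
        ([x+y]-[u+v]≈[x-u]+[y-v] (apply f x) (apply f y) (apply g x) (apply g y))
    ; homogeneous = λ k x → trans (+-cong (homogeneous f k x) (-‿cong (homogeneous g k x)))
        (sym (x[y-z]≈xy-xz k (apply f x) (apply g x)))
    }

  scaleColumns : ∀ {n} → Row n → LinearFunctional n → LinearFunctional n
  scaleColumns w f = record
    { apply       = λ x → apply f (λ s → x s * w s)
    ; apply-cong  = λ x≈y → apply-cong f (λ s → *-congʳ (x≈y s))
    ; additive    = λ x y → trans (apply-cong f (λ s → distribʳ (w s) (x s) (y s)))
                                  (additive f (λ s → x s * w s) (λ s → y s * w s))
    ; homogeneous = λ k x → trans (apply-cong f (λ s → *-assoc k (x s) (w s)))
                                  (homogeneous f k (λ s → x s * w s))
    }

  columnDifference : ∀ {n} → Carrier → Fin n → Fin n → LinearFunctional n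
  columnDifference k i j = record
    { apply       = λ x → k * (x i - x j)
    ; apply-cong  = λ x≈y → *-congˡ (+-cong (x≈y i) (-‿cong (x≈y j)))
    ; additive    = λ x y → trans (*-congˡ ([x+y]-[u+v]≈[x-u]+[y-v] (x i) (y i) (x j) (y j)))
        (distribˡ k (x i - x j) (y i - y j))
    ; homogeneous = λ a x → trans (*-congˡ (sym (x[y-z]≈xy-xz a (x i) (x j))))
        (x∙yz≈y∙xz k a (x i - x j))
    }

  columnDifference-equalColumns : ∀ {n} k (i j : Fin n) {x : Row n} → x i ≈ x j →
                                  apply (columnDifference k i j) x ≈ 0#
  columnDifference-equalColumns k i j xi≈xj =
    trans (*-congˡ (x≈y⇒x∙y⁻¹≈ε xi≈xj)) (zeroʳ k)

  SupportedOn : ∀ {n} → LinearFunctional n → (Fin n → Set) → Set (c ⊔ ℓ)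
  SupportedOn f S = ∀ x → (∀ s → S s → x s ≈ 0#) → apply f x ≈ 0#

  columnDifference-supported : ∀ {n} k {i j : Fin n} {S : Fin n → Set} → S i → S j →
                               SupportedOn (columnDifference k i j) S
  columnDifference-supported k {i} {j} Si Sj x x≈0 =
    columnDifference-equalColumns k i j (trans (x≈0 i Si) (sym (x≈0 j Sj)))

  scaleColumns-supported : ∀ {n} w (f : LinearFunctional n) {S} → SupportedOn f S →
                           SupportedOn (scaleColumns w f) S
  scaleColumns-supported w f f-supp x x≈0 =
    f-supp _ (λ s Ss → trans (*-congʳ (x≈0 s Ss)) (zeroˡ (w s)))

  Annihilates : ∀ {n} → SomeMatrix F n → LinearFunctional n → Set ℓ
  Annihilates (_ , A) f = ∀ r → apply f (A r) ≈ 0#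

  annihilates-scaleColumns-ones : ∀ {n} (X : SomeMatrix F n) f →
                                  Annihilates X f ⇔ Annihilates X (scaleColumns (λ _ → 1#) f)
  annihilates-scaleColumns-ones (_ , A) f = mk⇔
    (λ annA r → trans (apply-cong f (λ s → *-identityʳ (A r s))) (annA r))
    (λ annA r → trans (sym (apply-cong f (λ s → *-identityʳ (A r s)))) (annA r))

  swapRows-annihilates : ∀ {m n} {A B : Matrix F m n} (i j : Fin m) →
                         (∀ r s → B r s ≈ A (swapIdx F i j r) s) →
                         ∀ f → Annihilates (m , B) f ⇔ Annihilates (m , A) f
  swapRows-annihilates {A = A} {B} i j B≈swapA f = mk⇔
    (λ annB r → begin
      apply f (A r)                                 ≡⟨ ≡.cong (apply f ∘ A) (swapIdx-involutive F i j r) ⟨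
      apply f (A (swapIdx F i j (swapIdx F i j r))) ≈⟨ apply-cong f (B≈swapA (swapIdx F i j r)) ⟨
      apply f (B (swapIdx F i j r))                 ≈⟨ annB _ ⟩
      0#                                            ∎)
    (λ annA r → trans (apply-cong f (B≈swapA r)) (annA _))

  updateRow-annihilates : ∀ {m n} {A B : Matrix F m n} (i : Fin m) f →
                          (∀ r → r ≢ i → B r ≈ᵣ A r) →
                          (Annihilates (m , A) f → apply f (B i) ≈ 0#) →
                          (Annihilates (m , B) f → apply f (A i) ≈ 0#) →
                          Annihilates (m , B) f ⇔ Annihilates (m , A) f
  updateRow-annihilates {A = A} {B} i f B≈A-off-i newRow oldRow = mk⇔ toA toB
    where
    toA : Annihilates (_ , B) f → Annihilates (_ , A) f
    toA annB r with r ≟ i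
    ... | yes ≡.refl = oldRow annB
    ... | no r≢i     = trans (sym (apply-cong f (B≈A-off-i r r≢i))) (annB r)
    toB : Annihilates (_ , A) f → Annihilates (_ , B) f
    toB annA r with r ≟ i
    ... | yes ≡.refl = newRow annA
    ... | no r≢i     = trans (apply-cong f (B≈A-off-i r r≢i)) (annA r)

  scaleRow-annihilates : ∀ {m n} {A B : Matrix F m n} (i : Fin m) a → ¬ (a ≈ 0#) →
                         B i ≈ᵣ (λ s → a * A i s) → (∀ r → r ≢ i → B r ≈ᵣ A r) →
                         ∀ f → Annihilates (m , B) f ⇔ Annihilates (m , A) f
  scaleRow-annihilates i a a≉0 Bi≈aAi B≈A-off-i f = updateRow-annihilates i f B≈A-off-i
    (λ annA → trans (apply-scaled f a Bi≈aAi) (trans (*-congˡ (annA i)) (zeroʳ a)))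
    (λ annB → x*y≈0∧x≉0⇒y≈0 (trans (sym (apply-scaled f a Bi≈aAi)) (annB i)) a≉0)

  addRow-annihilates : ∀ {m n} {A B : Matrix F m n} (i j : Fin m) a → i ≢ j →
                       B i ≈ᵣ (λ s → A i s + a * A j s) → (∀ r → r ≢ i → B r ≈ᵣ A r) →
                       ∀ f → Annihilates (m , B) f ⇔ Annihilates (m , A) f
  addRow-annihilates {A = A} {B} i j a i≢j Bi≈Ai+aAj B≈A-off-i f =
    updateRow-annihilates i f B≈A-off-i
      (λ annA → trans (apply-+* f a Bi≈Ai+aAj)
                      (trans (+-cong (annA i) (trans (*-congˡ (annA j)) (zeroʳ a))) (+-identityʳ 0#)))
      (λ annB → x+ay≈0∧y≈0⇒x≈0 (trans (sym (apply-+* f a Bi≈Ai+aAj)) (annB i))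
                                (trans (sym (apply-cong f (B≈A-off-i j (i≢j ∘ ≡.sym)))) (annB j)))

  scaleColumns-annihilates : ∀ {m n} {A B : Matrix F m n} (w : Row n) →
                             (∀ r s → B r s ≈ A r s * w s) →
                             ∀ f → Annihilates (m , B) f ⇔ Annihilates (m , A) (scaleColumns w f)
  scaleColumns-annihilates w B≈Aw f = mk⇔
    (λ annB r → trans (sym (apply-cong f (B≈Aw r))) (annB r))
    (λ annA r → trans (apply-cong f (B≈Aw r)) (annA r))

  deleteZeroRow-annihilates : ∀ {m n} {A : Matrix F (ℕ.suc m) n} {B : Matrix F m n} →
                              DeleteZeroRow F A B →
                              ∀ f → Annihilates (m , B) f ⇔ Annihilates (ℕ.suc m , A) f
  deleteZeroRow-annihilates {A = A} {B} (k , Ak≈0 , B≈A-punchIn) f = mk⇔ toA toB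
    where
    toA : Annihilates (_ , B) f → Annihilates (_ , A) f
    toA annB r with k ≟ r
    ... | yes ≡.refl = apply-zero f Ak≈0
    ... | no k≢r     = begin
      apply f (A r)                          ≡⟨ ≡.cong (apply f ∘ A) (punchIn-punchOut k≢r) ⟨
      apply f (A (punchIn k (punchOut k≢r))) ≈⟨ apply-cong f (B≈A-punchIn (punchOut k≢r)) ⟨
      apply f (B (punchOut k≢r))             ≈⟨ annB _ ⟩
      0#                                     ∎
    toB : Annihilates (_ , A) f → Annihilates (_ , B) f
    toB annA r = trans (apply-cong f (B≈A-punchIn r)) (annA _)

  -- Row operations get the all-ones weight rather than no pullback at all, so that
  -- pullback step (f ⊖ g) and pullback step f ⊖ pullback step g agree definitionally.
  columnWeights : ∀ {n} {X Y : SomeMatrix F n} → Step F X Y → Row n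
  columnWeights (colScale _ _ w _ _) = w
  columnWeights _                    = λ _ → 1#

  pullback : ∀ {n} {X Y : SomeMatrix F n} → Step F X Y → LinearFunctional n → LinearFunctional n
  pullback step = scaleColumns (columnWeights step)

  step-annihilates : ∀ {n} {X Y : SomeMatrix F n} (step : Step F X Y) f →
                     Annihilates Y f ⇔ Annihilates X (pullback step f)
  step-annihilates (rowSwap A B i j B≈swapA) f =
    ⇔.trans (swapRows-annihilates i j B≈swapA f) (annihilates-scaleColumns-ones _ f)
  step-annihilates (rowScale A B i a a≉0 Bi≈aAi B≈A-off-i) f =
    ⇔.trans (scaleRow-annihilates i a a≉0 Bi≈aAi B≈A-off-i f) (annihilates-scaleColumns-ones _ f)
  step-annihilates (rowAdd A B i j a i≢j Bi≈Ai+aAj B≈A-off-i) f =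
    ⇔.trans (addRow-annihilates i j a i≢j Bi≈Ai+aAj B≈A-off-i f) (annihilates-scaleColumns-ones _ f)
  step-annihilates (colScale A B w _ B≈Aw) f = scaleColumns-annihilates w B≈Aw f
  step-annihilates (delZero A B A↦B) f =
    ⇔.trans (deleteZeroRow-annihilates A↦B f) (annihilates-scaleColumns-ones _ f)
  step-annihilates (addZero A B B↦A) f =
    ⇔.trans (⇔.sym (deleteZeroRow-annihilates B↦A f)) (annihilates-scaleColumns-ones _ f)

  -- Dually: the column spans of the sets S i share a vector which is not zero.
  record SpansMeet {n : ℕ} {I : Set} (S : I → Fin n → Set) (X : SomeMatrix F n) : Set (c ⊔ ℓ) where
    field
      functional : I → LinearFunctional n
      supported  : ∀ i → SupportedOn (functional i) (S i)
      agree      : ∀ i j → Annihilates X (functional i ⊖ functional j)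
      nontrivial : ¬ (∀ i → Annihilates X (functional i))

  step-reflects-spansMeet : ∀ {n I} {S : I → Fin n → Set} {X Y : SomeMatrix F n} →
                            Step F X Y → SpansMeet S Y → SpansMeet S X
  step-reflects-spansMeet step meet = record
    { functional = λ i → pullback step (functional i)
    ; supported  = λ i → scaleColumns-supported (columnWeights step) (functional i) (supported i)
    ; agree      = λ i j → to (step-annihilates step (functional i ⊖ functional j)) (agree i j)
    ; nontrivial = λ annX → nontrivial (λ i → from (step-annihilates step (functional i)) (annX i))
    }
    where open SpansMeet meet

  spansMeet-reflected : ∀ {n I} {S : I → Fin n → Set} {X Y : SomeMatrix F n} →
                        Star (Step F) X Y → SpansMeet S Y → SpansMeet S X
  spansMeet-reflected ε             meet = meet
  spansMeet-reflected (step ◅ steps) meet =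
    step-reflects-spansMeet step (spansMeet-reflected steps meet)

OutEdge : Vertex → Edge → Set
OutEdge v e = tail e ≡ v

successor : Vertex → Vertex
successor zero             = suc zero
successor (suc zero)       = suc (suc zero)
successor (suc (suc zero)) = zero

predecessor : Vertex → Vertex
predecessor zero             = suc (suc zero)
predecessor (suc zero)       = zero
predecessor (suc (suc zero)) = suc zero

predecessor-successor : ∀ v → predecessor (successor v) ≡ v
predecessor-successor zero             = ≡.refl
predecessor-successor (suc zero)       = ≡.refl
predecessor-successor (suc (suc zero)) = ≡.refl

edge-avoids-predecessor-of-tail : ∀ e → predecessor (tail e) ≢ tail e × predecessor (tail e) ≢ head e
edge-avoids-predecessor-of-tail zero                                = (λ ()) , (λ ())
edge-avoids-predecessor-of-tail (suc zero)                          = (λ ()) , (λ ())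
edge-avoids-predecessor-of-tail (suc (suc zero))                    = (λ ()) , (λ ())
edge-avoids-predecessor-of-tail (suc (suc (suc zero)))              = (λ ()) , (λ ())
edge-avoids-predecessor-of-tail (suc (suc (suc (suc zero))))        = (λ ()) , (λ ())
edge-avoids-predecessor-of-tail (suc (suc (suc (suc (suc zero))))) = (λ ()) , (λ ())

firstOut secondOut : Vertex → Edge
firstOut zero              = zero
firstOut (suc zero)        = suc (suc zero)
firstOut (suc (suc zero))  = suc (suc (suc (suc zero)))
secondOut zero             = suc zero
secondOut (suc zero)       = suc (suc (suc zero))
secondOut (suc (suc zero)) = suc (suc (suc (suc (suc zero))))

firstOut-out : ∀ v → OutEdge v (firstOut v)
firstOut-out zero             = ≡.refl
firstOut-out (suc zero)       = ≡.refl
firstOut-out (suc (suc zero)) = ≡.refl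

secondOut-out : ∀ v → OutEdge v (secondOut v)
secondOut-out zero             = ≡.refl
secondOut-out (suc zero)       = ≡.refl
secondOut-out (suc (suc zero)) = ≡.refl

outPair-parallel : ∀ v → Parallel (firstOut v) (secondOut v)
outPair-parallel zero             = (λ ()) , ≡.refl , ≡.refl
outPair-parallel (suc zero)       = (λ ()) , ≡.refl , ≡.refl
outPair-parallel (suc (suc zero)) = (λ ()) , ≡.refl , ≡.refl

module DoubledTriangle {c ℓ : Level} (F : Field c ℓ) where
  open Field F hiding (zero)
  open RowSpace F
  open RingProperties ring using (x≈y⇒x∙y⁻¹≈ε)
  open SetoidReasoning setoid

  δ-≢ : ∀ {m} {i j : Fin m} → i ≢ j → δ F i j ≈ 0#
  δ-≢ {i = i} {j} i≢j with i ≟ j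
  ... | yes i≡j = ⊥-elim (i≢j i≡j)
  ... | no _    = refl

  frame-entry-zero : ∀ φ {u e} → u ≢ tail e → u ≢ head e → frameMatrix F φ u e ≈ 0#
  frame-entry-zero φ {u} {e} u≢tail u≢head = begin
    δ F u (tail e) - MultGain.φ φ (e , true) * δ F u (head e)
      ≈⟨ +-cong (δ-≢ u≢tail) (-‿cong (trans (*-congˡ (δ-≢ u≢head)) (zeroʳ _))) ⟩
    0# - 0#
      ≈⟨ -‿inverseʳ 0# ⟩
    0# ∎

  frameRow-vanishes-on-successor : ∀ φ u e → OutEdge (successor u) e → frameMatrix F φ u e ≈ 0#
  frameRow-vanishes-on-successor φ u e out = uncurry (frame-entry-zero φ)
    (≡.subst (λ v → v ≢ tail e × v ≢ head e) predecessor-of-tail (edge-avoids-predecessor-of-tail e))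
    where
    predecessor-of-tail : predecessor (tail e) ≡ u
    predecessor-of-tail = ≡.trans (≡.cong predecessor out) (predecessor-successor u)

  frame-spansDisjoint : ∀ φ → ¬ SpansMeet OutEdge (3 , frameMatrix F φ)
  frame-spansDisjoint φ meet = nontrivial vanishes
    where
    open SpansMeet meet
    vanishes : ∀ v → Annihilates (3 , frameMatrix F φ) (functional v)
    vanishes v u = x-y≈0∧y≈0⇒x≈0 (agree v (successor u) u)
      (supported (successor u) (frameMatrix F φ u) (frameRow-vanishes-on-successor φ u))

  module Lift (ψ : AddGain F) (unbalanced : ¬ AddBalanced2Cycle F ψ) where
    open AddGain ψ using (inv) renaming (ψ to gain)

    outGainGap : Vertex → Carrier
    outGainGap v = gain (firstOut v , true) - gain (secondOut v , true)

    outGainGap≉0 : ∀ v → ¬ (outGainGap v ≈ 0#)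
    outGainGap≉0 v gap≈0 = unbalanced
      (firstOut v , secondOut v , outPair-parallel v , trans (+-congˡ (inv (secondOut v))) gap≈0)

    outFunctional : Vertex → LinearFunctional 6
    outFunctional v = columnDifference (proj₁ (inverse _ (outGainGap≉0 v))) (firstOut v) (secondOut v)

    outFunctional-apexRow : ∀ v → apply (outFunctional v) (liftMatrix F ψ zero) ≈ 1#
    outFunctional-apexRow v = trans (*-comm _ (outGainGap v)) (proj₂ (inverse _ (outGainGap≉0 v)))

    outFunctional-vertexRow : ∀ v u → apply (outFunctional v) (liftMatrix F ψ (suc u)) ≈ 0#
    outFunctional-vertexRow v u with outPair-parallel v
    ... | _ , sameTail , sameHead =
      columnDifference-equalColumns _ (firstOut v) (secondOut v) {liftMatrix F ψ (suc u)}
        (reflexive (≡.cong₂ (λ t h → δ F u t - δ F u h) sameTail sameHead))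

    lift-spansMeet : SpansMeet OutEdge (4 , liftMatrix F ψ)
    lift-spansMeet = record
      { functional = outFunctional
      ; supported  = λ v → columnDifference-supported _ (firstOut-out v) (secondOut-out v)
      ; agree      = agree
      ; nontrivial = λ ann → 1≉0 (trans (sym (outFunctional-apexRow zero)) (ann zero zero))
      }
      where
      agree : ∀ v w → Annihilates (4 , liftMatrix F ψ) (outFunctional v ⊖ outFunctional w)
      agree v w zero    = x≈y⇒x∙y⁻¹≈ε (trans (outFunctional-apexRow v) (sym (outFunctional-apexRow w)))
      agree v w (suc u) = x≈y⇒x∙y⁻¹≈ε (trans (outFunctional-vertexRow v u) (sym (outFunctional-vertexRow w u)))

mainTheorem12 : ∀ {c ℓ : Level} (F : Field c ℓ) (φ : MultGain F) (ψ : AddGain F) →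
                  ¬ MultBalanced2Cycle F φ → ¬ AddBalanced2Cycle F ψ →
                  ¬ ProjEquiv F (frameMatrix F φ) (liftMatrix F ψ)
mainTheorem12 F φ ψ _ ψ-unbalanced frame~lift =
  frame-spansDisjoint φ (spansMeet-reflected frame~lift (lift-spansMeet ψ ψ-unbalanced))
  where
  open RowSpace F using (spansMeet-reflected)
  open DoubledTriangle F using (frame-spansDisjoint)
  open DoubledTriangle.Lift F using (lift-spansMeet)
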